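{- Let $n\ge1$ and $C\in DC(n)$. For all $i\in[2n]$, $$\tau_C(i)=i+l_C(e_i)-r_C(e_i).$$
   Context: A Dellac configuration of size $n$ is a placement of $2n$ dots in a grid with $n$ columns (indexed $1..n$ left to right) and $2n$ rows (indexed $1..2n$ bottom to top) such that each row has exactly one dot, each column exactly two dots, and each dot in column $j$, row $i$ satisfies $j\le i\le j+n$; $DC(n)$ is their set. An inversion of $C$ is a pair of dots with (column,row) coordinates $(j_1,i_1),(j_2,i_2)$, $j_1<j_2$, $i_1>i_2$. The dot in row $i\le n$ is labeled $e_i=2i+2$ and the dot in row $n+i$ ($i\in[n]$) is labeled $e_{n+i}=2i-1$; dots are identified with their labels. For $j\in[n]$, $i_1(j)<i_2(j)$ are the row indices of the two dots in column $j$. For $i\in[2n]$, $l_C(e_i)$ (resp. $r_C(e_i)$) is the number of inversions of $C$ formed by the dot $e_i$ and a dot $e_{i'}$ with $i'>i$ (resp. $i'<i$). $\phi(C)\in\mathfrak{S}_{2n+2}$ is defined by $\phi(C)^{ -1}(1)=2$, $\phi(C)^{ -1}(2j)=e_{i_2(j)}$, $\phi(C)^{ -1}(2j+1)=e_{i_1(j)}$ for $j\in[n]$, $\phi(C)^{ -1}(2n+2)=2n+1$. Let $(y_1,\dots,y_{2n})=(3,2,5,4,\dots,2n+1,2n)$, i.e. $y_{2m-1}=2m+1$, $y_{2m}=2m$. The permutation $\tau_C\in\mathfrak{S}_{2n}$ is defined by $\phi(C)(e_i)=y_{\tau_C(i)}$ for all $i\in[2n]$. -}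

module Defs where

open import Data.Nat using (ℕ; zero; suc; _+_; _*_; _∸_; _≤_; _<_; _≤ᵇ_; _<ᵇ_; _≡ᵇ_; _%_; _/_)
open import Data.Bool using (Bool; true; false; if_then_else_; _∧_; T)
open import Data.Bool.Properties using (T?)
open import Data.List using (List; []; _∷_; map; filter; length; upTo; reverse)
open import Data.Product using (_×_)
open import Relation.Binary.PropositionalEquality using (_≡_)

-- Rows are 1..2n, columns 1..n (1-indexed natural numbers).
rows : ℕ → List ℕ
rows n = map suc (upTo (2 * n))

countB : (ℕ → Bool) → List ℕ → ℕ
countB p xs = length (filter (λ x → T? (p x)) xs)

-- first element of a list satisfying a boolean predicate (0 if none)
firstB : (ℕ → Bool) → List ℕ → ℕ
firstB p [] = 0
firstB p (x ∷ xs) = if p x then x else firstB p xs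

-- A Dellac configuration of size n, described by the column  col i  of the
-- unique dot in row i (i ∈ [1..2n]); this encodes "exactly one dot per row".
record DC (n : ℕ) : Set where
  field
    col         : ℕ → ℕ
    col-range   : ∀ i → 1 ≤ i → i ≤ 2 * n → 1 ≤ col i × col i ≤ n
    col-bound   : ∀ i → 1 ≤ i → i ≤ 2 * n → col i ≤ i × i ≤ col i + n
    two-per-col : ∀ j → 1 ≤ j → j ≤ n →
                  countB (λ i → col i ≡ᵇ j) (rows n) ≡ 2

open DC public

module _ {n : ℕ} (C : DC n) where

  -- label of the dot in row i
  e : ℕ → ℕ
  e i = if i ≤ᵇ n then 2 * i + 2 else 2 * (i ∸ n) ∸ 1

  -- i₁(j) < i₂(j): the rows of the two dots in column j
  i₁ : ℕ → ℕ
  i₁ j = firstB (λ i → col C i ≡ᵇ j) (rows n)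

  i₂ : ℕ → ℕ
  i₂ j = firstB (λ i → col C i ≡ᵇ j) (reverse (rows n))

  -- l_C(e_i): inversions of dot e_i with dots e_{i'}, i' > i
  -- (a pair of dots (j₁,r₁),(j₂,r₂) with j₁ < j₂, r₁ > r₂)
  lC : ℕ → ℕ
  lC i = countB (λ i' → (i <ᵇ i') ∧ (col C i' <ᵇ col C i)) (rows n)

  rC : ℕ → ℕ
  rC i = countB (λ i' → (i' <ᵇ i) ∧ (col C i <ᵇ col C i')) (rows n)

  -- φ(C)⁻¹ as a function on [1..2n+2]
  φinv : ℕ → ℕ
  φinv v =
    if v ≡ᵇ 1 then 2
    else if v ≡ᵇ 2 * n + 2 then 2 * n + 1
    else if v % 2 ≡ᵇ 0 then e (i₂ (v / 2))
    else e (i₁ (v / 2))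

  y : ℕ → ℕ
  y k = if k % 2 ≡ᵇ 1 then k + 2 else k

  -- τ_C(i): the k ∈ [1..2n] with φ(C)(e_i) = y_k, i.e. φ(C)⁻¹(y_k) = e_i
  τ : ℕ → ℕ
  τ i = firstB (λ k → φinv (y k) ≡ᵇ e i) (rows n)

module Submission where

-- Fix a dot e_i, in row i and column j = j' + 1, and split the
-- other dots according to whether they lie below or above row i and left of,
-- in, or right of column j.  With P = #(below, left), A = #(below, same
-- column), B = #(above, same column), r = r_C(e_i) = #(below, right) and
-- l = l_C(e_i) = #(above, left), counting the rows below i, the dots in the
-- columns left of j, and the two dots of column j gives
--     i - 1 = P + A + r,     2j' = P + l,     A + B = 1.
-- On the other side φ(C)⁻¹(y_{2j-1}) = φ(C)⁻¹(2j+1) = e_{i₁(j)} and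
-- φ(C)⁻¹(y_{2j}) = φ(C)⁻¹(2j) = e_{i₂(j)}, and no other position k has
-- φ(C)⁻¹(y_k) = e_i; since i = i₁(j) exactly when A = 0 (and i = i₂(j) when
-- B = 0), this gives τ_C(i) = 2j' + 1 + A.  Hence τ_C(i) + r = i + l.

open import Defs
open import Data.Nat using (ℕ; _≤_; _*_)
open import Relation.Binary.PropositionalEquality using (_≡_)

module DellacBalance where

  open import Data.Nat
  open import Data.Nat.Properties
  open import Data.Nat.DivMod using ([m+kn]%n≡m%n; m*n%n≡0; m*n/n≡m; +-distrib-/)
  open import Data.Nat.Solver using (module +-*-Solver)
  open +-*-Solver using (solve; _:=_; _:+_)
  open import Algebra.Properties.CommutativeSemigroup +-commutativeSemigroup using (interchange)
  open import Data.Bool using (Bool; true; false; if_then_else_; _∧_)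
  open import Data.Bool.Properties using (∧-comm)
  open import Data.List using (List; []; _∷_; _++_; applyUpTo; reverse)
  open import Data.List.Properties using (map-upTo; reverse-++)
  open import Data.Product using (∃; _×_; _,_; proj₁; proj₂)
  open import Data.Sum using (_⊎_; inj₁; inj₂)
  open import Data.Empty using (⊥; ⊥-elim)
  open import Function using (_∘_)
  open import Relation.Nullary using (yes; no)
  open import Relation.Binary.PropositionalEquality
  open ≡-Reasoning

  ind : Bool → ℕ
  ind true  = 1
  ind false = 0

  ind≡0 : ∀ {b} → ind b ≡ 0 → b ≡ false
  ind≡0 {false} _ = refl

  <ᵇ-true : ∀ {m n} → m < n → (m <ᵇ n) ≡ true
  <ᵇ-true {zero}  (s≤s _)   = refl
  <ᵇ-true {suc m} (s≤s m<n) = <ᵇ-true m<n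

  ≤ᵇ-true : ∀ {m n} → m ≤ n → (m ≤ᵇ n) ≡ true
  ≤ᵇ-true {zero}  _   = refl
  ≤ᵇ-true {suc m} m<n = <ᵇ-true m<n

  <ᵇ-false : ∀ {m n} → n ≤ m → (m <ᵇ n) ≡ false
  <ᵇ-false z≤n       = refl
  <ᵇ-false (s≤s n≤m) = <ᵇ-false n≤m

  ≡ᵇ-refl : ∀ m → (m ≡ᵇ m) ≡ true
  ≡ᵇ-refl zero    = refl
  ≡ᵇ-refl (suc m) = ≡ᵇ-refl m

  ≡ᵇ-true : ∀ {m n} → m ≡ n → (m ≡ᵇ n) ≡ true
  ≡ᵇ-true {m} refl = ≡ᵇ-refl m

  ≡ᵇ-false : ∀ {m n} → m ≢ n → (m ≡ᵇ n) ≡ false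
  ≡ᵇ-false {zero}  {zero}  m≢n = ⊥-elim (m≢n refl)
  ≡ᵇ-false {zero}  {suc n} _   = refl
  ≡ᵇ-false {suc m} {zero}  _   = refl
  ≡ᵇ-false {suc m} {suc n} m≢n = ≡ᵇ-false (m≢n ∘ cong suc)

  ≡ᵇ-sound : ∀ {m n} → (m ≡ᵇ n) ≡ true → m ≡ n
  ≡ᵇ-sound {zero}  {zero}  _  = refl
  ≡ᵇ-sound {suc m} {suc n} eq = cong suc (≡ᵇ-sound eq)

  trichotomyᵇ : ∀ u v → ind (u <ᵇ v) + ind (u ≡ᵇ v) + ind (v <ᵇ u) ≡ 1
  trichotomyᵇ zero    zero    = refl
  trichotomyᵇ zero    (suc v) = refl
  trichotomyᵇ (suc u) zero    = refl
  trichotomyᵇ (suc u) (suc v) = trichotomyᵇ u v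

  <ᵇ-suc : ∀ u v → ind (u <ᵇ suc v) ≡ ind (u <ᵇ v) + ind (u ≡ᵇ v)
  <ᵇ-suc zero    zero    = refl
  <ᵇ-suc zero    (suc v) = refl
  <ᵇ-suc (suc u) zero    = refl
  <ᵇ-suc (suc u) (suc v) = <ᵇ-suc u v

  split-by-compareʳ : ∀ b u v →
    ind b ≡ ind (b ∧ (u <ᵇ v)) + ind (b ∧ (u ≡ᵇ v)) + ind (b ∧ (v <ᵇ u))
  split-by-compareʳ false u v = refl
  split-by-compareʳ true  u v = sym (trichotomyᵇ u v)

  split-by-compareˡ : ∀ b u v →
    ind b ≡ ind ((u <ᵇ v) ∧ b) + ind ((u ≡ᵇ v) ∧ b) + ind ((v <ᵇ u) ∧ b)
  split-by-compareˡ b u v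
    rewrite ∧-comm (u <ᵇ v) b | ∧-comm (u ≡ᵇ v) b | ∧-comm (v <ᵇ u) b =
    split-by-compareʳ b u v

  +≡1 : ∀ a b → a + b ≡ 1 → (a ≡ 0 × b ≡ 1) ⊎ (a ≡ 1 × b ≡ 0)
  +≡1 zero          b a+b≡1 = inj₁ (refl , a+b≡1)
  +≡1 (suc zero)    b a+b≡1 = inj₂ (refl , suc-injective a+b≡1)
  +≡1 (suc (suc a)) b ()

  ∑ : (ℕ → ℕ) → List ℕ → ℕ
  ∑ f []       = 0
  ∑ f (x ∷ xs) = f x + ∑ f xs

  countB≡∑ : ∀ p xs → countB p xs ≡ ∑ (ind ∘ p) xs
  countB≡∑ p []       = refl
  countB≡∑ p (x ∷ xs) with p x
  ... | true  = cong suc (countB≡∑ p xs)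
  ... | false = countB≡∑ p xs

  ∑-cong : ∀ {f g} xs → (∀ x → f x ≡ g x) → ∑ f xs ≡ ∑ g xs
  ∑-cong []       f≗g = refl
  ∑-cong (x ∷ xs) f≗g = cong₂ _+_ (f≗g x) (∑-cong xs f≗g)

  ∑-+ : ∀ f g xs → ∑ (λ x → f x + g x) xs ≡ ∑ f xs + ∑ g xs
  ∑-+ f g []       = refl
  ∑-+ f g (x ∷ xs) = begin
    f x + g x + ∑ (λ x → f x + g x) xs ≡⟨ cong (f x + g x +_) (∑-+ f g xs) ⟩
    f x + g x + (∑ f xs + ∑ g xs)      ≡⟨ interchange (f x) (g x) (∑ f xs) (∑ g xs) ⟩
    f x + ∑ f xs + (g x + ∑ g xs)      ∎

  ∑-split₃ : ∀ {f g h k} xs → (∀ x → f x ≡ g x + h x + k x) →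
             ∑ f xs ≡ ∑ g xs + ∑ h xs + ∑ k xs
  ∑-split₃ {f} {g} {h} {k} xs f≡ = begin
    ∑ f xs                                      ≡⟨ ∑-cong xs f≡ ⟩
    ∑ (λ x → g x + h x + k x) xs                ≡⟨ ∑-+ (λ x → g x + h x) k xs ⟩
    ∑ (λ x → g x + h x) xs + ∑ k xs             ≡⟨ cong (_+ ∑ k xs) (∑-+ g h xs) ⟩
    ∑ g xs + ∑ h xs + ∑ k xs                    ∎

  interval : ℕ → ℕ → List ℕ
  interval a zero    = []
  interval a (suc m) = a ∷ interval (suc a) m

  applyUpTo-interval : ∀ (f : ℕ → ℕ) a m → (∀ x → f x ≡ a + x) → applyUpTo f m ≡ interval a m
  applyUpTo-interval f a zero    f≗a+ = refl
  applyUpTo-interval f a (suc m) f≗a+ = cong₂ _∷_ (trans (f≗a+ 0) (+-identityʳ a))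
    (applyUpTo-interval (f ∘ suc) (suc a) m (λ x → trans (f≗a+ (suc x)) (+-suc a x)))

  rows≡interval : ∀ n → rows n ≡ interval 1 (2 * n)
  rows≡interval n = trans (map-upTo suc (2 * n)) (applyUpTo-interval suc 1 (2 * n) (λ _ → refl))

  empty-interval : ∀ {a x} → a ≤ x → x < a + 0 → ⊥
  empty-interval {a} a≤x x<a+0 = <⇒≱ (subst (_ <_) (+-identityʳ a) x<a+0) a≤x

  <-shift : ∀ {x a m} → x < a + suc m → x < suc a + m
  <-shift {x} {a} {m} = subst (x <_) (+-suc a m)

  <-unshift : ∀ {x a m} → x < suc a + m → x < a + suc m
  <-unshift {x} {a} {m} = subst (x <_) (sym (+-suc a m))

  ∑-zero : ∀ f a m → (∀ x → a ≤ x → x < a + m → f x ≡ 0) → ∑ f (interval a m) ≡ 0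
  ∑-zero f a zero    _    = refl
  ∑-zero f a (suc m) f≡0 = cong₂ _+_ (f≡0 a ≤-refl (m<m+n a z<s))
    (∑-zero f (suc a) m (λ x a<x x<end → f≡0 x (<⇒≤ a<x) (<-unshift x<end)))

  ∑-zero⁻¹ : ∀ f a m → ∑ f (interval a m) ≡ 0 → ∀ x → a ≤ x → x < a + m → f x ≡ 0
  ∑-zero⁻¹ f a zero    _    x a≤x x<end = ⊥-elim (empty-interval a≤x x<end)
  ∑-zero⁻¹ f a (suc m) ∑≡0 x a≤x x<end with m≤n⇒m<n∨m≡n a≤x
  ... | inj₂ refl = m+n≡0⇒m≡0 (f a) ∑≡0
  ... | inj₁ a<x  = ∑-zero⁻¹ f (suc a) m (m+n≡0⇒n≡0 (f a) ∑≡0) x a<x (<-shift x<end)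

  ∑-below : ∀ b a m → a ≤ b → b ≤ a + m → ∑ (λ x → ind (x <ᵇ b)) (interval a m) ≡ b ∸ a
  ∑-below b a zero a≤b b≤a+0 with ≤-antisym a≤b (subst (b ≤_) (+-identityʳ a) b≤a+0)
  ... | refl = sym (n∸n≡0 a)
  ∑-below b a (suc m) a≤b b≤end with m≤n⇒m<n∨m≡n a≤b
  ... | inj₁ a<b rewrite <ᵇ-true a<b =
        trans (cong suc (∑-below b (suc a) m a<b (subst (b ≤_) (+-suc a m) b≤end)))
              (sym (+-∸-assoc 1 a<b))
  ... | inj₂ refl rewrite <ᵇ-false (≤-refl {a}) | n∸n≡0 a =
        ∑-zero _ (suc a) m (λ x a<x _ → cong ind (<ᵇ-false (<⇒≤ a<x)))

  ∑-at : ∀ (q : ℕ → Bool) a m i → a ≤ i → i < a + m →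
         ∑ (λ x → ind ((x ≡ᵇ i) ∧ q x)) (interval a m) ≡ ind (q i)
  ∑-at q a zero    i a≤i i<end = ⊥-elim (empty-interval a≤i i<end)
  ∑-at q a (suc m) i a≤i i<end with m≤n⇒m<n∨m≡n a≤i
  ... | inj₁ a<i rewrite ≡ᵇ-false (<⇒≢ a<i) = ∑-at q (suc a) m i a<i (<-shift i<end)
  ... | inj₂ refl rewrite ≡ᵇ-refl a =
        trans (cong (ind (q a) +_) (∑-zero _ (suc a) m (λ x a<x _ →
          cong (λ b → ind (b ∧ q x)) (≡ᵇ-false (>⇒≢ a<x)))))
        (+-identityʳ _)

  firstB-sound : ∀ p xs → firstB p xs ≡ 0 ⊎ p (firstB p xs) ≡ true
  firstB-sound p []       = inj₁ refl
  firstB-sound p (x ∷ xs) with p x in px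
  ... | true  = inj₂ px
  ... | false = firstB-sound p xs

  firstB-least : ∀ p a m x → a ≤ x → x < a + m → p x ≡ true →
                 (∀ z → a ≤ z → z < x → p z ≡ false) → firstB p (interval a m) ≡ x
  firstB-least p a zero    x a≤x x<end _  _       = ⊥-elim (empty-interval a≤x x<end)
  firstB-least p a (suc m) x a≤x x<end px earlier with m≤n⇒m<n∨m≡n a≤x
  ... | inj₂ refl rewrite px = refl
  ... | inj₁ a<x rewrite earlier a ≤-refl a<x =
        firstB-least p (suc a) m x a<x (<-shift x<end) px (λ z a<z → earlier z (<⇒≤ a<z))

  firstB-minimal : ∀ p a m z → a ≤ z → z < firstB p (interval a m) → p z ≡ false
  firstB-minimal p a zero    z a≤z ()
  firstB-minimal p a (suc m) z a≤z z<first with p a in pa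
  ... | true  = ⊥-elim (<⇒≱ z<first a≤z)
  ... | false with m≤n⇒m<n∨m≡n a≤z
  ...   | inj₂ refl = pa
  ...   | inj₁ a<z  = firstB-minimal p (suc a) m z a<z z<first

  reverse-interval : ∀ a m → reverse (interval a (suc m)) ≡ (a + m) ∷ reverse (interval a m)
  reverse-interval a m = trans (cong reverse (interval-snoc a m)) (reverse-++ (interval a m) (a + m ∷ []))
    where
    interval-snoc : ∀ a m → interval a (suc m) ≡ interval a m ++ (a + m ∷ [])
    interval-snoc a zero    = cong (_∷ []) (sym (+-identityʳ a))
    interval-snoc a (suc m) = cong (a ∷_) (trans (interval-snoc (suc a) m)
                                (cong (λ z → interval (suc a) m ++ (z ∷ [])) (sym (+-suc a m))))

  lastB-greatest : ∀ p a m x → a ≤ x → x < a + m → p x ≡ true →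
                   (∀ z → x < z → z < a + m → p z ≡ false) → firstB p (reverse (interval a m)) ≡ x
  lastB-greatest p a zero    x a≤x x<end _  _     = ⊥-elim (empty-interval a≤x x<end)
  lastB-greatest p a (suc m) x a≤x x<end px later rewrite reverse-interval a m
    with m≤n⇒m<n∨m≡n (s≤s⁻¹ (subst (x <_) (+-suc a m) x<end))
  ... | inj₂ refl rewrite px = refl
  ... | inj₁ x<a+m rewrite later (a + m) x<a+m (<-unshift (n<1+n (a + m))) =
        lastB-greatest p a m x a≤x x<a+m px (λ z x<z z<a+m → later z x<z (<-trans z<a+m (<-unshift (n<1+n (a + m)))))

  even%2 : ∀ m → (2 * m) % 2 ≡ 0
  even%2 m = trans (cong (_% 2) (*-comm 2 m)) (m*n%n≡0 m 2)

  even/2 : ∀ m → (2 * m) / 2 ≡ m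
  even/2 m = trans (cong (_/ 2) (*-comm 2 m)) (m*n/n≡m m 2)

  odd%2 : ∀ m → suc (2 * m) % 2 ≡ 1
  odd%2 m = trans (cong (λ x → suc x % 2) (*-comm 2 m)) ([m+kn]%n≡m%n 1 m 2)

  odd/2 : ∀ m → suc (2 * m) / 2 ≡ m
  odd/2 m = begin
    suc (2 * m) / 2   ≡⟨ cong (λ x → suc x / 2) (*-comm 2 m) ⟩
    (1 + m * 2) / 2   ≡⟨ +-distrib-/ 1 (m * 2) (subst (λ r → 1 + r < 2) (sym (m*n%n≡0 m 2)) ≤-refl) ⟩
    m * 2 / 2         ≡⟨ m*n/n≡m m 2 ⟩
    m                 ∎

  even-or-odd : ∀ k → (∃ λ m → k ≡ 2 * m) ⊎ (∃ λ m → k ≡ suc (2 * m))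
  even-or-odd zero = inj₁ (0 , refl)
  even-or-odd (suc k) with even-or-odd k
  ... | inj₁ (m , k≡2m)   = inj₂ (m , cong suc k≡2m)
  ... | inj₂ (m , k≡2m+1) = inj₁ (suc m , trans (cong suc k≡2m+1) (sym (*-suc 2 m)))

  module _ {n : ℕ} (C : DC n) where

    c : ℕ → ℕ
    c = col C

    allRows : List ℕ
    allRows = interval 1 (2 * n)

    count : (ℕ → Bool) → ℕ
    count p = ∑ (ind ∘ p) allRows

    count-rows : ∀ p → countB p (rows n) ≡ count p
    count-rows p = trans (cong (countB p) (rows≡interval n)) (countB≡∑ p allRows)

    count-split-by-column : ∀ b i → count b ≡
      count (λ x → b x ∧ (c x <ᵇ c i)) + count (λ x → b x ∧ (c x ≡ᵇ c i)) + count (λ x → b x ∧ (c i <ᵇ c x))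
    count-split-by-column b i = ∑-split₃ allRows (λ x → split-by-compareʳ (b x) (c x) (c i))

    count-split-by-row : ∀ b i → count b ≡
      count (λ x → (x <ᵇ i) ∧ b x) + count (λ x → (x ≡ᵇ i) ∧ b x) + count (λ x → (i <ᵇ x) ∧ b x)
    count-split-by-row b i = ∑-split₃ allRows (λ x → split-by-compareˡ (b x) x i)

    i₁-interval : ∀ j → i₁ C j ≡ firstB (λ x → c x ≡ᵇ j) allRows
    i₁-interval j = cong (firstB _) (rows≡interval n)

    i₂-interval : ∀ j → i₂ C j ≡ firstB (λ x → c x ≡ᵇ j) (reverse allRows)
    i₂-interval j = cong (firstB _ ∘ reverse) (rows≡interval n)

    τ-interval : ∀ i → τ C i ≡ firstB (λ k → φinv C (y C k) ≡ᵇ e C i) allRows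
    τ-interval i = cong (firstB _) (rows≡interval n)

    two-dots : ∀ j → 1 ≤ j → j ≤ n → count (λ x → c x ≡ᵇ j) ≡ 2
    two-dots j 1≤j j≤n = trans (sym (count-rows _)) (two-per-col C j 1≤j j≤n)

    dots-left-of : ∀ j' → j' ≤ n → count (λ x → c x <ᵇ suc j') ≡ 2 * j'
    dots-left-of zero    _      = ∑-zero _ 1 (2 * n) (λ x 1≤x x≤2n →
      cong ind (<ᵇ-false (proj₁ (col-range C x 1≤x (s≤s⁻¹ x≤2n)))))
    dots-left-of (suc j') j'<n = begin
      count (λ x → c x <ᵇ suc (suc j'))                      ≡⟨ ∑-cong allRows (λ x → <ᵇ-suc (c x) (suc j')) ⟩
      ∑ (λ x → ind (c x <ᵇ suc j') + ind (c x ≡ᵇ suc j')) allRows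
        ≡⟨ ∑-+ (λ x → ind (c x <ᵇ suc j')) (λ x → ind (c x ≡ᵇ suc j')) allRows ⟩
      count (λ x → c x <ᵇ suc j') + count (λ x → c x ≡ᵇ suc j')
        ≡⟨ cong₂ _+_ (dots-left-of j' (<⇒≤ j'<n)) (two-dots (suc j') (s≤s z≤n) j'<n) ⟩
      2 * j' + 2                                              ≡⟨ +-comm (2 * j') 2 ⟩
      2 + 2 * j'                                              ≡⟨ sym (*-suc 2 j') ⟩
      2 * suc j'                                              ∎

    i₁-column : ∀ j i → i₁ C j ≡ i → 1 ≤ i → c i ≡ j
    i₁-column j i i₁≡i 1≤i with firstB-sound (λ x → c x ≡ᵇ j) (rows n)
    ... | inj₁ i₁≡0 = ⊥-elim (<⇒≢ 1≤i (sym (trans (sym i₁≡i) i₁≡0)))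
    ... | inj₂ hit  = subst (λ r → c r ≡ j) i₁≡i (≡ᵇ-sound hit)

    i₂-column : ∀ j i → i₂ C j ≡ i → 1 ≤ i → c i ≡ j
    i₂-column j i i₂≡i 1≤i with firstB-sound (λ x → c x ≡ᵇ j) (reverse (rows n))
    ... | inj₁ i₂≡0 = ⊥-elim (<⇒≢ 1≤i (sym (trans (sym i₂≡i) i₂≡0)))
    ... | inj₂ hit  = subst (λ r → c r ≡ j) i₂≡i (≡ᵇ-sound hit)

    label-low : ∀ i → i ≤ n → e C i ≡ 2 * suc i
    label-low i i≤n rewrite ≤ᵇ-true i≤n = trans (+-comm (2 * i) 2) (sym (*-suc 2 i))

    label-high : ∀ d → e C (suc d + n) ≡ suc (2 * d)
    label-high d rewrite <ᵇ-false (m≤n+m n d) | m+n∸n≡m (suc d) n = +-suc d (d + 0)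

    label-cases : ∀ i → (e C i ≡ 2 * suc i) ⊎ (∃ λ d → i ≡ suc d + n × e C i ≡ suc (2 * d))
    label-cases i with i ≤? n
    ... | yes i≤n = inj₁ (label-low i i≤n)
    ... | no  i≰n = inj₂ (d , i≡ , subst (λ r → e C r ≡ suc (2 * d)) (sym i≡) (label-high d))
      where
      d : ℕ
      d = i ∸ suc n
      i≡ : i ≡ suc d + n
      i≡ = sym (trans (sym (+-suc d n)) (m∸n+n≡m (≰⇒> i≰n)))

    label-injective : ∀ i i' → e C i ≡ e C i' → i ≡ i'
    label-injective i i' eq with label-cases i | label-cases i'
    ... | inj₁ ei | inj₁ ei' = suc-injective (*-cancelˡ-≡ _ _ 2 (trans (sym ei) (trans eq ei')))
    ... | inj₂ (d , i≡ , ei) | inj₂ (d' , i'≡ , ei') =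
          trans i≡ (trans (cong (λ z → suc z + n) (*-cancelˡ-≡ _ _ 2 (suc-injective (trans (sym ei) (trans eq ei')))))
                          (sym i'≡))
    ... | inj₁ ei | inj₂ (d' , _ , ei') = ⊥-elim (even≢odd (suc i) d' (trans (sym ei) (trans eq ei')))
    ... | inj₂ (d , _ , ei) | inj₁ ei' = ⊥-elim (even≢odd (suc i') d (trans (sym ei') (trans (sym eq) ei)))

    φinv-generic : ∀ v → v ≢ 1 → v ≢ 2 * n + 2 →
      φinv C v ≡ (if v % 2 ≡ᵇ 0 then e C (i₂ C (v / 2)) else e C (i₁ C (v / 2)))
    φinv-generic v v≢1 v≢top rewrite ≡ᵇ-false v≢1 | ≡ᵇ-false v≢top = refl

    2n+2≡2[n+1] : 2 * n + 2 ≡ 2 * suc n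
    2n+2≡2[n+1] = trans (+-comm (2 * n) 2) (sym (*-suc 2 n))

    φinv-odd : ∀ j → 1 ≤ j → φinv C (suc (2 * j)) ≡ e C (i₁ C j)
    φinv-odd (suc j) _ rewrite φinv-generic (suc (2 * suc j)) (λ ())
                                 (λ eq → even≢odd (suc n) (suc j) (trans (sym 2n+2≡2[n+1]) (sym eq)))
                             | odd%2 (suc j) | odd/2 (suc j) = refl

    φinv-even : ∀ j → 1 ≤ j → j ≤ n → φinv C (2 * j) ≡ e C (i₂ C j)
    φinv-even j _ j≤n rewrite φinv-generic (2 * j) (even≢odd j 0)
                                (λ eq → <⇒≱ (s≤s j≤n) (≤-reflexive (sym (*-cancelˡ-≡ j (suc n) 2 (trans eq 2n+2≡2[n+1])))))
                            | even%2 j | even/2 j = refl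

    y-odd : ∀ m → y C (suc (2 * m)) ≡ suc (2 * suc m)
    y-odd m rewrite odd%2 m = cong suc (trans (+-comm (2 * m) 2) (sym (*-suc 2 m)))

    y-even : ∀ m → y C (2 * m) ≡ 2 * m
    y-even m rewrite even%2 m = refl

    φinv-y-odd : ∀ j' → φinv C (y C (suc (2 * j'))) ≡ e C (i₁ C (suc j'))
    φinv-y-odd j' = trans (cong (φinv C) (y-odd j')) (φinv-odd (suc j') (s≤s z≤n))

    φinv-y-even : ∀ j → 1 ≤ j → j ≤ n → φinv C (y C (2 * j)) ≡ e C (i₂ C j)
    φinv-y-even j 1≤j j≤n = trans (cong (φinv C) (y-even j)) (φinv-even j 1≤j j≤n)

    preimage : ∀ i j' k → c i ≡ suc j' → 1 ≤ i → 1 ≤ k → k ≤ 2 * n → φinv C (y C k) ≡ e C i →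
               (k ≡ suc (2 * j') × i₁ C (suc j') ≡ i) ⊎ (k ≡ 2 * suc j' × i₂ C (suc j') ≡ i)
    preimage i j' k col-i 1≤i 1≤k k≤2n hit with even-or-odd k
    ... | inj₂ (m , refl) = inj₁ (cong (λ t → suc (2 * t)) m≡j' , subst (λ t → i₁ C (suc t) ≡ i) m≡j' i₁≡i)
      where
      i₁≡i : i₁ C (suc m) ≡ i
      i₁≡i = label-injective _ _ (trans (sym (φinv-y-odd m)) hit)
      m≡j' : m ≡ j'
      m≡j' = suc-injective (trans (sym (i₁-column (suc m) i i₁≡i 1≤i)) col-i)
    ... | inj₁ (zero , refl) = ⊥-elim (<-irrefl refl 1≤k)
    ... | inj₁ (suc m , refl) = inj₂ (cong (λ t → 2 * suc t) m≡j' , subst (λ t → i₂ C (suc t) ≡ i) m≡j' i₂≡i)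
      where
      i₂≡i : i₂ C (suc m) ≡ i
      i₂≡i = label-injective _ _ (trans (sym (φinv-y-even (suc m) (s≤s z≤n) (*-cancelˡ-≤ 2 k≤2n))) hit)
      m≡j' : m ≡ j'
      m≡j' = suc-injective (trans (sym (i₂-column (suc m) i i₂≡i 1≤i)) col-i)

    τ-at : ∀ i K → 1 ≤ K → K ≤ 2 * n → φinv C (y C K) ≡ e C i →
           (∀ k → 1 ≤ k → k < K → φinv C (y C k) ≢ e C i) → τ C i ≡ K
    τ-at i K 1≤K K≤2n hit earlier = trans (τ-interval i)
      (firstB-least _ 1 (2 * n) K 1≤K (s≤s K≤2n) (≡ᵇ-true hit) (λ k 1≤k k<K → ≡ᵇ-false (earlier k 1≤k k<K)))

    module RowAnalysis (i₀ j' : ℕ) (row-bound : suc i₀ ≤ 2 * n) (column : c (suc i₀) ≡ suc j') where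

      i : ℕ
      i = suc i₀

      i<end : i < 1 + 2 * n
      i<end = s≤s row-bound

      column-bound : suc j' ≤ n
      column-bound = subst (_≤ n) column (proj₂ (col-range C i (s≤s z≤n) row-bound))

      odd<even : suc (2 * j') < 2 * suc j'
      odd<even = subst (suc (2 * j') <_) (sym (*-suc 2 j')) ≤-refl

      even≤2n : 2 * suc j' ≤ 2 * n
      even≤2n = *-monoʳ-≤ 2 column-bound

      P A R L B : ℕ
      P = count (λ x → (x <ᵇ i) ∧ (c x <ᵇ c i))
      A = count (λ x → (x <ᵇ i) ∧ (c x ≡ᵇ c i))
      R = count (λ x → (x <ᵇ i) ∧ (c i <ᵇ c x))
      L = count (λ x → (i <ᵇ x) ∧ (c x <ᵇ c i))
      B = count (λ x → (i <ᵇ x) ∧ (c x ≡ᵇ c i))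

      rows-below : i₀ ≡ P + A + R
      rows-below = trans (sym (∑-below i 1 (2 * n) (s≤s z≤n) (<⇒≤ i<end)))
                         (count-split-by-column (λ x → x <ᵇ i) i)

      dots-left : 2 * j' ≡ P + L
      dots-left = begin
        2 * j'                                          ≡⟨ sym (dots-left-of j' (<⇒≤ column-bound)) ⟩
        count (λ x → c x <ᵇ suc j')                     ≡⟨ cong (λ t → count (λ x → c x <ᵇ t)) (sym column) ⟩
        count (λ x → c x <ᵇ c i)                        ≡⟨ count-split-by-row (λ x → c x <ᵇ c i) i ⟩
        P + count (λ x → (x ≡ᵇ i) ∧ (c x <ᵇ c i)) + L
          ≡⟨ cong (λ t → P + t + L) (∑-at (λ x → c x <ᵇ c i) 1 (2 * n) i (s≤s z≤n) i<end) ⟩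
        P + ind (c i <ᵇ c i) + L                         ≡⟨ cong (λ b → P + ind b + L) (<ᵇ-false (≤-refl {c i})) ⟩
        P + 0 + L                                       ≡⟨ cong (_+ L) (+-identityʳ P) ⟩
        P + L                                           ∎

      column-partner : A + B ≡ 1
      column-partner = suc-injective (begin
        suc (A + B)                                     ≡⟨ cong (_+ B) (+-comm 1 A) ⟩
        A + 1 + B                                       ≡⟨ cong (λ b → A + ind b + B) (sym (≡ᵇ-refl (c i))) ⟩
        A + ind (c i ≡ᵇ c i) + B                        ≡⟨ cong (λ t → A + t + B) (sym at-i) ⟩
        A + count (λ x → (x ≡ᵇ i) ∧ (c x ≡ᵇ c i)) + B   ≡⟨ sym (count-split-by-row (λ x → c x ≡ᵇ c i) i) ⟩
        count (λ x → c x ≡ᵇ c i)                        ≡⟨ two-dots (c i) (proj₁ range) (proj₂ range) ⟩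
        2                                               ∎)
        where
        range : 1 ≤ c i × c i ≤ n
        range = col-range C i (s≤s z≤n) row-bound
        at-i : count (λ x → (x ≡ᵇ i) ∧ (c x ≡ᵇ c i)) ≡ ind (c i ≡ᵇ c i)
        at-i = ∑-at (λ x → c x ≡ᵇ c i) 1 (2 * n) i (s≤s z≤n) i<end

      none-below : A ≡ 0 → ∀ z → 1 ≤ z → z < i → (c z ≡ᵇ suc j') ≡ false
      none-below A≡0 z 1≤z z<i = subst (λ t → (c z ≡ᵇ t) ≡ false) column
        (ind≡0 (subst (λ b → ind (b ∧ (c z ≡ᵇ c i)) ≡ 0) (<ᵇ-true z<i)
                      (∑-zero⁻¹ _ 1 (2 * n) A≡0 z 1≤z (<-trans z<i i<end))))

      lower-row : A ≡ 0 → i₁ C (suc j') ≡ i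
      lower-row A≡0 = trans (i₁-interval (suc j'))
        (firstB-least _ 1 (2 * n) i (s≤s z≤n) i<end (≡ᵇ-true column) (none-below A≡0))

      lower-row⁻¹ : i₁ C (suc j') ≡ i → A ≡ 0
      lower-row⁻¹ i₁≡i = ∑-zero _ 1 (2 * n) not-below
        where
        not-below : ∀ z → 1 ≤ z → z < 1 + 2 * n → ind ((z <ᵇ i) ∧ (c z ≡ᵇ c i)) ≡ 0
        not-below z 1≤z _ with z <? i
        ... | no  z≮i rewrite <ᵇ-false (≮⇒≥ z≮i) = refl
        ... | yes z<i rewrite <ᵇ-true z<i = cong ind (subst (λ t → (c z ≡ᵇ t) ≡ false) (sym column)
                (firstB-minimal _ 1 (2 * n) z 1≤z (subst (z <_) (trans (sym i₁≡i) (i₁-interval (suc j'))) z<i)))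

      none-above : B ≡ 0 → ∀ z → i < z → z < 1 + 2 * n → (c z ≡ᵇ suc j') ≡ false
      none-above B≡0 z i<z z<end = subst (λ t → (c z ≡ᵇ t) ≡ false) column
        (ind≡0 (subst (λ b → ind (b ∧ (c z ≡ᵇ c i)) ≡ 0) (<ᵇ-true i<z)
                      (∑-zero⁻¹ _ 1 (2 * n) B≡0 z (≤-trans (s≤s z≤n) i<z) z<end)))

      upper-row : B ≡ 0 → i₂ C (suc j') ≡ i
      upper-row B≡0 = trans (i₂-interval (suc j'))
        (lastB-greatest _ 1 (2 * n) i (s≤s z≤n) i<end (≡ᵇ-true column) (none-above B≡0))

      τ-lower : A ≡ 0 → τ C i ≡ suc (2 * j')
      τ-lower A≡0 = τ-at i (suc (2 * j')) (s≤s z≤n) odd≤2n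
                         (trans (φinv-y-odd j') (cong (e C) (lower-row A≡0))) earlier
        where
        odd≤2n : suc (2 * j') ≤ 2 * n
        odd≤2n = ≤-trans (<⇒≤ odd<even) even≤2n
        earlier : ∀ k → 1 ≤ k → k < suc (2 * j') → φinv C (y C k) ≢ e C i
        earlier k 1≤k k<odd hit with preimage i j' k column (s≤s z≤n) 1≤k (≤-trans (<⇒≤ k<odd) odd≤2n) hit
        ... | inj₁ (refl , _) = <-irrefl refl k<odd
        ... | inj₂ (refl , _) = <-asym k<odd odd<even

      τ-upper : A ≡ 1 → B ≡ 0 → τ C i ≡ 2 * suc j'
      τ-upper A≡1 B≡0 = τ-at i (2 * suc j') (s≤s z≤n) even≤2n
                             (trans (φinv-y-even (suc j') (s≤s z≤n) column-bound) (cong (e C) (upper-row B≡0))) earlier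
        where
        earlier : ∀ k → 1 ≤ k → k < 2 * suc j' → φinv C (y C k) ≢ e C i
        earlier k 1≤k k<even hit with preimage i j' k column (s≤s z≤n) 1≤k (≤-trans (<⇒≤ k<even) even≤2n) hit
        ... | inj₁ (_ , i₁≡i) = 0≢1+n (trans (sym (lower-row⁻¹ i₁≡i)) A≡1)
        ... | inj₂ (refl , _) = <-irrefl refl k<even

      τ-value : τ C i ≡ suc (2 * j' + A)
      τ-value with +≡1 A B column-partner
      ... | inj₁ (A≡0 , _)   = trans (τ-lower A≡0) (cong suc (sym (trans (cong (2 * j' +_) A≡0) (+-identityʳ _))))
      ... | inj₂ (A≡1 , B≡0) = trans (τ-upper A≡1 B≡0)
                                     (trans (*-suc 2 j') (cong suc (sym (trans (cong (2 * j' +_) A≡1) (+-comm (2 * j') 1)))))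

      balance : τ C i + rC C i ≡ i + lC C i
      balance = begin
        τ C i + rC C i          ≡⟨ cong₂ _+_ τ-value (count-rows _) ⟩
        suc (2 * j' + A) + R    ≡⟨ cong (λ t → suc (t + A + R)) dots-left ⟩
        suc (P + L + A + R)     ≡⟨ cong suc (solve 4 (λ P L A R → P :+ L :+ A :+ R := P :+ A :+ R :+ L) refl P L A R) ⟩
        suc (P + A + R + L)     ≡⟨ cong (λ t → suc (t + L)) (sym rows-below) ⟩
        i + L                   ≡⟨ cong (i +_) (sym (count-rows _)) ⟩
        i + lC C i              ∎

    balance : ∀ i → 1 ≤ i → i ≤ 2 * n → τ C i + rC C i ≡ i + lC C i
    balance (suc i₀) _ i≤2n = RowAnalysis.balance i₀ (pred (c (suc i₀))) i≤2n column
      where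
      column : c (suc i₀) ≡ suc (pred (c (suc i₀)))
      column = sym (suc-pred (c (suc i₀)) {{>-nonZero (proj₁ (col-range C (suc i₀) (s≤s z≤n) i≤2n))}})

open DellacBalance using (balance)

import Data.Nat as ℕ
open import Data.Nat.Properties using (m+n∸n≡m; m≤n+m)
open import Data.Integer using (+_; _+_; _-_; _⊖_)
open import Data.Integer.Properties using (⊖-≥; [+m]-[+n]≡m⊖n; pos-+)
open import Relation.Binary.PropositionalEquality using (cong; sym; module ≡-Reasoning)
open ≡-Reasoning

ℕ-balance⇒ℤ : ∀ a b l r → a ℕ.+ r ≡ b ℕ.+ l → + a ≡ (+ b + + l) - + r
ℕ-balance⇒ℤ a b l r a+r≡b+l = begin
  + a                  ≡⟨ cong +_ (sym (m+n∸n≡m a r)) ⟩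
  + (a ℕ.+ r ℕ.∸ r)    ≡⟨ sym (⊖-≥ (m≤n+m r a)) ⟩
  (a ℕ.+ r) ⊖ r        ≡⟨ cong (_⊖ r) a+r≡b+l ⟩
  (b ℕ.+ l) ⊖ r        ≡⟨ sym ([+m]-[+n]≡m⊖n (b ℕ.+ l) r) ⟩
  + (b ℕ.+ l) - + r    ≡⟨ cong (_- + r) (pos-+ b l) ⟩
  (+ b + + l) - + r    ∎

proposition4 : (n : ℕ) → 1 ≤ n → (C : DC n) → (i : ℕ) → 1 ≤ i → i ≤ 2 * n →
                 + (τ C i) ≡ (+ i + + (lC C i)) - + (rC C i)
proposition4 n _ C i 1≤i i≤2n = ℕ-balance⇒ℤ (τ C i) i (lC C i) (rC C i) (balance C i 1≤i i≤2n)
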